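{- Let $n,k,r,s$ be positive integers with $k\geq 2$, $r\geq 2$ and $n\geq \max(\{r,s\})k$. Then $$\chi\left(KG^{r}(n,k)_{s\text{ - }stab}\right)\leq \chi\left(KG^{r}(n,k)_{\widetilde{s\text{ - }stab}}\right)\leq \left\lceil \frac{n-\max(\{r,s\})(k-1)}{r-1}\right\rceil .$$
   Context: For a $k$-subset $S\subseteq[n]=\{1,\dots,n\}$: $S$ is $s$-stable if $s\leq |i-j|\leq n-s$ for all distinct $i,j\in S$, and almost $s$-stable if $|i-j|\geq s$ for all distinct $i,j\in S$. $KG^{r}(n,k)_{s\text{ - }stab}$ (resp. $KG^{r}(n,k)_{\widetilde{s\text{ - }stab}}$) is the $r$-uniform hypergraph whose vertices are the $s$-stable (resp. almost $s$-stable) $k$-subsets of $[n]$ and whose edges are the $r$-element sets of pairwise disjoint such subsets. A proper coloring of a hypergraph is a map from its vertices to colors so that no edge is monochromatic; $\chi$ denotes the minimum number of colors of a proper coloring. -}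

module Defs where

open import Data.Nat using (ℕ; zero; suc; _+_; _*_; _∸_; _≤_; _⊔_; ∣_-_∣)
open import Data.Nat.DivMod using (_/_)
open import Data.Fin using (Fin; toℕ)
open import Data.Fin.Subset using (Subset; _∈_; ∣_∣)
open import Data.Product using (Σ; _×_)
open import Relation.Binary.PropositionalEquality using (_≡_; _≢_)
open import Relation.Nullary using (¬_)

-- Ground set [n] is represented by Fin n (element i stands for i+1;
-- differences |i-j| are unaffected by this shift).

Stable : (n s : ℕ) → Subset n → Set
Stable n s S = ∀ (i j : Fin n) → i ∈ S → j ∈ S → i ≢ j →
  (s ≤ ∣ toℕ i - toℕ j ∣) × (∣ toℕ i - toℕ j ∣ ≤ n ∸ s)

AlmostStable : (n s : ℕ) → Subset n → Set
AlmostStable n s S = ∀ (i j : Fin n) → i ∈ S → j ∈ S → i ≢ j →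
  s ≤ ∣ toℕ i - toℕ j ∣

Disjoint : {n : ℕ} → Subset n → Subset n → Set
Disjoint {n} A B = ∀ (x : Fin n) → ¬ (x ∈ A × x ∈ B)

Vertex : (n k : ℕ) → (Subset n → Set) → Set
Vertex n k P = Σ (Subset n) (λ S → (∣ S ∣ ≡ k) × P S)

-- An edge of KG^r(n,k)_P is an r-element set of pairwise disjoint vertices;
-- we present it as a family e : Fin r → Vertex with e a, e b disjoint for a ≢ b
-- (for k ≥ 1 the members are nonempty, hence pairwise distinct, so the
-- family determines exactly an r-element set).
IsEdge : (n k r : ℕ) (P : Subset n → Set) → (Fin r → Vertex n k P) → Set
IsEdge n k r P e = ∀ (a b : Fin r) → a ≢ b →
  Disjoint (Σ.proj₁ (e a)) (Σ.proj₁ (e b))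

ProperColoring : (n k r : ℕ) (P : Subset n → Set) (m : ℕ) →
  (Vertex n k P → Fin m) → Set
ProperColoring n k r P m c = ∀ (e : Fin r → Vertex n k P) → IsEdge n k r P e →
  ¬ (∀ (a b : Fin r) → c (e a) ≡ c (e b))

Colorable : (n k r : ℕ) (P : Subset n → Set) (m : ℕ) → Set
Colorable n k r P m = Σ (Vertex n k P → Fin m) (ProperColoring n k r P m)

IsChromaticNumber : (n k r : ℕ) (P : Subset n → Set) (m : ℕ) → Set
IsChromaticNumber n k r P m =
  Colorable n k r P m × (∀ (m' : ℕ) → Colorable n k r P m' → m ≤ m')

-- ceiling division ⌈ a / b ⌉ (only used with b ≥ 1; value 0 for b = 0)
ceilDiv : ℕ → ℕ → ℕ
ceilDiv a zero = 0
ceilDiv a (suc b) = (a + b) / suc b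

module Submission where

-- Constructively, "χ is m" needs a least colorable number, so the file first shows
-- that colorability with m colors is decidable: colorings are functions on the
-- finite type Subset n, and function spaces over finite domains are searchable
-- for predicates respecting pointwise equality.  A least colorable number then
-- exists as soon as some coloring is known, which gives both chromatic numbers.
-- Every s-stable set is almost s-stable, so restricting colorings gives χs ≤ χa.
-- For the upper bound, with d = r-1 and q the ceiling in the statement, a vertex
-- S gets color min(⌊first S/d⌋, q-1), where first S is its least element.  The
-- least elements of the r disjoint members of an edge are distinct, so they
-- cannot all fall into one block of d consecutive positions (pigeonhole); in the
-- top color this is forced when s ≥ r (an almost s-stable k-set starts before
-- n - s(k-1)), while for s < r the top block leaves fewer than rk positions for
-- the r disjoint k-sets of the edge.

open import Defs
open import Data.Nat using (ℕ; zero; suc; _+_; _*_; _∸_; _/_; _%_; _≤_; _<_; _⊔_; _⊓_; z≤n; s≤s; _≤?_; NonZero)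
import Data.Nat.Properties as ℕP
open import Data.Nat.DivMod using (m≡m%n+[m/n]*n; m%n<n; m/n*n≤m; m<n*o⇒m/o<n; m≥n⇒m/n>0)
open import Data.Fin using (Fin; zero; suc; toℕ; fromℕ<)
import Data.Fin.Properties as FinP
open import Data.Fin.Subset using (Subset; inside; outside; _∈_; ∣_∣; Nonempty)
open import Data.Fin.Subset.Properties using (_∈?_; anySubset?)
open import Data.Vec using ([]; _∷_; tail; here; there)
import Data.Vec.Functional as Vector
open import Data.Product using (Σ; ∃; _×_; _,_; proj₁; proj₂)
open import Data.Sum using (_⊎_; inj₁; inj₂)
open import Data.Bool using (Bool)
open import Data.Empty using (⊥; ⊥-elim)
open import Function using (_∘_)
open import Function.Definitions using (Injective)
open import Relation.Nullary using (¬_; Dec; yes; no)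
open import Relation.Nullary.Decidable using (map′; decidable-stable; _×-dec_; _→-dec_; ¬?)
open import Relation.Unary using (Decidable)
open import Relation.Binary.PropositionalEquality using (_≡_; _≢_; _≗_; refl; sym; trans; cong; cong₂; subst; module ≡-Reasoning)
open import Algebra.Properties.CommutativeMonoid.Sum ℕP.+-0-commutativeMonoid using (sum; sum-cong-≗; ∑-distrib-+; sum-replicate-zero)

Searchable : Set → Set₁
Searchable A = {P : A → Set} → Decidable P → Dec (∃ P)

searchable-Fin : (m : ℕ) → Searchable (Fin m)
searchable-Fin m P? = FinP.any? P?

searchable-Subset : (n : ℕ) → Searchable (Subset n)
searchable-Subset n P? = anySubset? P?

-- Without function extensionality a function space is only searchable for
-- predicates that respect pointwise equality.
Extensional : {D A : Set} → ((D → A) → Set) → Set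
Extensional P = ∀ {f g} → f ≗ g → P f → P g

FunctionsSearchable : Set → Set → Set₁
FunctionsSearchable D A =
  {P : (D → A) → Set} → Extensional P → Decidable P → Dec (∃ P)

-- A function on Fin (suc r) is a head value together with a function on Fin r.
searchable-Fin→ : {B : Set} → Searchable B → (r : ℕ) → FunctionsSearchable (Fin r) B
searchable-Fin→ {B} search-B zero ext P? =
  map′ (λ p → no-values , p) (λ (f , p) → ext (λ ()) p) (P? no-values)
  where
  no-values : Fin 0 → B
  no-values ()
searchable-Fin→ search-B (suc r) {P} ext P? =
  map′ (λ (b , h , p) → b Vector.∷ h , p) split
       (search-B (λ b → searchable-Fin→ search-B r (ext ∘ cons-cong b) (P? ∘ (b Vector.∷_))))
  where
  cons-cong : ∀ b {h h′} → h ≗ h′ → (b Vector.∷ h) ≗ (b Vector.∷ h′)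
  cons-cong b eq zero    = refl
  cons-cong b eq (suc i) = eq i

  split : ∃ P → ∃ λ b → ∃ λ h → P (b Vector.∷ h)
  split (f , p) = f zero , f ∘ suc , ext (λ { zero → refl ; (suc i) → refl }) p

-- A function on Subset (suc n) is a pair of functions on Subset n, one for
-- subsets containing the first point and one for those that do not.
searchable-Subset→ : {A : Set} → Searchable A → (n : ℕ) → FunctionsSearchable (Subset n) A
searchable-Subset→ search-A zero ext P? =
  map′ (λ (a , p) → (λ _ → a) , p) (λ (f , p) → f [] , ext (λ { [] → refl }) p)
       (search-A (λ a → P? (λ _ → a)))
searchable-Subset→ {A} search-A (suc n) {P} ext P? =
  map′ (λ (g , h , p) → join g h , p) split
       (searchable-Subset→ search-A n
          (λ g≗g′ (h , p) → h , ext (join-cong g≗g′ (λ _ → refl)) p)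
          (λ g → searchable-Subset→ search-A n (ext ∘ join-cong (λ _ → refl)) (P? ∘ join g)))
  where
  join : (Subset n → A) → (Subset n → A) → Subset (suc n) → A
  join g h (inside  ∷ S) = g S
  join g h (outside ∷ S) = h S

  join-cong : ∀ {g g′ h h′} → g ≗ g′ → h ≗ h′ → join g h ≗ join g′ h′
  join-cong g≗g′ h≗h′ (inside  ∷ S) = g≗g′ S
  join-cong g≗g′ h≗h′ (outside ∷ S) = h≗h′ S

  split : ∃ P → ∃ λ g → ∃ λ h → P (join g h)
  split (f , p) = f ∘ (inside ∷_) , f ∘ (outside ∷_) ,
                  ext (λ { (inside ∷ S) → refl ; (outside ∷ S) → refl }) p

decide-∀ : {D A : Set} → FunctionsSearchable D A → {Q : (D → A) → Set} →
           Extensional Q → Decidable Q → Dec (∀ f → Q f)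
decide-∀ search ext Q? =
  map′ (λ no-counterexample f → decidable-stable (Q? f) (λ ¬q → no-counterexample (f , ¬q)))
       (λ all-q (f , ¬q) → ¬q (all-q f))
       (¬? (search (λ f≗g ¬q q → ¬q (ext (sym ∘ f≗g) q)) (¬? ∘ Q?)))

PairwiseDisjoint : {n r : ℕ} → (Fin r → Subset n) → Set
PairwiseDisjoint t = ∀ a b → a ≢ b → Disjoint (t a) (t b)

module _ (n k r : ℕ) (P : Subset n → Set) (P? : Decidable P) (a₀ : Fin r) where

  IsVertex : Subset n → Set
  IsVertex S = (∣ S ∣ ≡ k) × P S

  isVertex? : Decidable IsVertex
  isVertex? S = (∣ S ∣ ℕP.≟ k) ×-dec P? S

  NotMonochromaticOn : {m : ℕ} → (Subset n → Fin m) → (Fin r → Subset n) → Set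
  NotMonochromaticOn f t =
    (∀ a → IsVertex (t a)) → PairwiseDisjoint t → ¬ (∀ a b → f (t a) ≡ f (t b))

  notMonochromaticOn? : {m : ℕ} (f : Subset n → Fin m) → Decidable (NotMonochromaticOn f)
  notMonochromaticOn? f t =
    FinP.all? (isVertex? ∘ t) →-dec
    (FinP.all? (λ a → FinP.all? (λ b → ¬? (a FinP.≟ b) →-dec disjoint? (t a) (t b))) →-dec
    ¬? (FinP.all? (λ a → FinP.all? (λ b → f (t a) FinP.≟ f (t b)))))
    where
    disjoint? : (A B : Subset n) → Dec (Disjoint A B)
    disjoint? A B = FinP.all? (λ x → ¬? ((x ∈? A) ×-dec (x ∈? B)))

  ProperOnSubsets : {m : ℕ} → (Subset n → Fin m) → Set
  ProperOnSubsets f = ∀ t → NotMonochromaticOn f t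

  properOnSubsets? : {m : ℕ} → Decidable (ProperOnSubsets {m})
  properOnSubsets? f =
    decide-∀ (searchable-Fin→ (searchable-Subset n) r) respects (notMonochromaticOn? f)
    where
    respects : Extensional (NotMonochromaticOn f)
    respects t≗t′ not-mono vertices disjoint mono =
      not-mono (λ a → subst IsVertex (sym (t≗t′ a)) (vertices a))
               (λ a b a≢b x (x∈a , x∈b) →
                  disjoint a b a≢b x (subst (x ∈_) (t≗t′ a) x∈a , subst (x ∈_) (t≗t′ b) x∈b))
               (λ a b → trans (cong f (t≗t′ a)) (trans (mono a b) (cong f (sym (t≗t′ b)))))

  properOnSubsets-respects : {m : ℕ} → Extensional (ProperOnSubsets {m})
  properOnSubsets-respects f≗g proper t vertices disjoint mono =
    proper t vertices disjoint (λ a b → trans (f≗g (t a)) (trans (mono a b) (sym (f≗g (t b)))))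

  extend-coloring : {m : ℕ} → Colorable n k r P (suc m) → ∃ (ProperOnSubsets {suc m})
  extend-coloring {m} (c , proper) = extend , λ t vertices disjoint mono →
    proper (λ a → t a , proj₁ (agrees (t a) (vertices a))) disjoint
           (λ a b → trans (sym (proj₂ (agrees (t a) (vertices a))))
                    (trans (mono a b) (proj₂ (agrees (t b) (vertices b)))))
    where
    extend : Subset n → Fin (suc m)
    extend S with isVertex? S
    ... | yes v = c (S , v)
    ... | no  _ = zero

    agrees : ∀ S → IsVertex S → Σ (IsVertex S) λ v → extend S ≡ c (S , v)
    agrees S v with isVertex? S
    ... | yes v′ = v′ , refl
    ... | no ¬v  = ⊥-elim (¬v v)

  colorable? : (m : ℕ) → Dec (Colorable n k r P m)
  colorable? zero =
    map′ (λ no-vertex → (λ v → ⊥-elim (no-vertex v)) , λ e _ _ → no-vertex (e a₀))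
         (λ (c , _) v → fin0 (c v))
         (¬? (searchable-Subset n isVertex?))
    where
    fin0 : Fin 0 → ⊥
    fin0 ()
  colorable? (suc m) =
    map′ (λ (f , proper) → (f ∘ proj₁) , λ e → proper (proj₁ ∘ e) (proj₂ ∘ e))
         extend-coloring
         (searchable-Subset→ (searchable-Fin (suc m)) n properOnSubsets-respects properOnSubsets?)

module _ {Q : ℕ → Set} (Q? : Decidable Q) where

  private
    Least : ℕ → Set
    Least m = Q m × (∀ j → j < m → ¬ Q j)

    leastBelow : (b : ℕ) → Σ ℕ Least ⊎ (∀ j → j < b → ¬ Q j)
    leastBelow zero = inj₂ (λ j ())
    leastBelow (suc b) with leastBelow b
    ... | inj₁ found = inj₁ found
    ... | inj₂ none-below with Q? b
    ...   | yes q = inj₁ (b , q , none-below)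
    ...   | no ¬q = inj₂ λ j j<1+b → case≤ (ℕP.m≤n⇒m<n∨m≡n (ℕP.≤-pred j<1+b))
      where
      case≤ : ∀ {j} → j < b ⊎ j ≡ b → ¬ Q j
      case≤ (inj₁ j<b) = none-below _ j<b
      case≤ (inj₂ refl) = ¬q

    minimal : ∀ {m} → (∀ j → j < m → ¬ Q j) → ∀ m′ → Q m′ → m ≤ m′
    minimal none-below m′ qm′ = ℕP.≮⇒≥ (λ m′<m → none-below m′ m′<m qm′)

  least : (b : ℕ) → Q b → Σ ℕ λ m → Q m × (∀ m′ → Q m′ → m ≤ m′)
  least b q with leastBelow b
  ... | inj₁ (m , qm , none-below) = m , qm , minimal none-below
  ... | inj₂ none-below            = b , q , minimal none-below

chromatic-number : {n k r : ℕ} {P : Subset n → Set} → Decidable P → Fin r →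
                   {b : ℕ} → Colorable n k r P b → Σ ℕ (IsChromaticNumber n k r P)
chromatic-number {n} {k} {r} {P} P? a₀ = least (colorable? n k r P P? a₀) _

restrict-coloring : {n k r m : ℕ} {P P′ : Subset n → Set} → (∀ {S} → P S → P′ S) →
                    Colorable n k r P′ m → Colorable n k r P m
restrict-coloring P⊆P′ (c , proper) =
  (λ (S , size , p) → c (S , size , P⊆P′ p)) ,
  λ e edge mono → proper (λ a → let (S , size , p) = e a in S , size , P⊆P′ p) edge mono

chromatic-numbers-ordered : {n k r b : ℕ} {P P′ : Subset n → Set} →
  Decidable P → Decidable P′ → Fin r → (∀ {S} → P S → P′ S) → Colorable n k r P′ b →
  Σ ℕ λ χ → Σ ℕ λ χ′ →
    IsChromaticNumber n k r P χ × IsChromaticNumber n k r P′ χ′ × (χ ≤ χ′) × (χ′ ≤ b)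
chromatic-numbers-ordered P? P′? a₀ P⊆P′ colorable-b =
  let (χ′ , colorable′ , minimal′) = chromatic-number P′? a₀ colorable-b
      restricted                  = restrict-coloring P⊆P′ colorable′
      (χ  , colorable  , minimal)  = chromatic-number P? a₀ restricted
  in χ , χ′ , (colorable , minimal) , (colorable′ , minimal′) ,
     minimal χ′ restricted , minimal′ _ colorable-b

almostStable? : (n s : ℕ) → Decidable (AlmostStable n s)
almostStable? n s S = FinP.all? λ i → FinP.all? λ j →
  (i ∈? S) →-dec (j ∈? S) →-dec ¬? (i FinP.≟ j) →-dec (s ≤? _)

stable? : (n s : ℕ) → Decidable (Stable n s)
stable? n s S = FinP.all? λ i → FinP.all? λ j →
  (i ∈? S) →-dec (j ∈? S) →-dec ¬? (i FinP.≟ j) →-dec ((s ≤? _) ×-dec (_ ≤? _))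

stable⇒almostStable : {n s : ℕ} {S : Subset n} → Stable n s S → AlmostStable n s S
stable⇒almostStable stable i j i∈S j∈S i≢j = proj₁ (stable i j i∈S j∈S i≢j)

-- first S is the position of the least element of S (meaningful for S nonempty).
first : {n : ℕ} → Subset n → ℕ
first []            = 0
first (inside  ∷ S) = 0
first (outside ∷ S) = suc (first S)

first-≤ : {n : ℕ} (S : Subset n) {i : Fin n} → i ∈ S → first S ≤ toℕ i
first-≤ (inside  ∷ S) _            = z≤n
first-≤ (outside ∷ S) (there i∈S) = s≤s (first-≤ S i∈S)

first-∈ : {n : ℕ} (S : Subset n) → Nonempty S → Σ (Fin n) λ j → j ∈ S × toℕ j ≡ first S
first-∈ (inside  ∷ S) _                  = zero , here , refl
first-∈ (outside ∷ S) (suc i , there i∈S) =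
  let (j , j∈S , j-first) = first-∈ S (i , i∈S) in suc j , there j∈S , cong suc j-first

size⇒nonempty : {n m : ℕ} (S : Subset n) → ∣ S ∣ ≡ suc m → Nonempty S
size⇒nonempty (inside  ∷ S) _    = zero , here
size⇒nonempty (outside ∷ S) size = let (i , i∈S) = size⇒nonempty S size in suc i , there i∈S

distinct-firsts : {n r : ℕ} (S : Fin r → Subset n) → (∀ a → Nonempty (S a)) →
                  PairwiseDisjoint S → Injective _≡_ _≡_ (first ∘ S)
distinct-firsts S nonempty disjoint {a} {b} same-first with a FinP.≟ b
... | yes a≡b = a≡b
... | no  a≢b =
  let (i , i∈a , i-first) = first-∈ (S a) (nonempty a)
      (j , j∈b , j-first) = first-∈ (S b) (nonempty b)
      i≡j = FinP.toℕ-injective (trans i-first (trans same-first (sym j-first)))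
  in ⊥-elim (disjoint a b a≢b i (i∈a , subst (_∈ S b) (sym i≡j) j∈b))

no-common-block : (d : ℕ) .{{_ : NonZero d}} (x : Fin (suc d) → ℕ) →
                  Injective _≡_ _≡_ x → (t : ℕ) → ¬ (∀ a → x a / d ≡ t)
no-common-block d x x-injective t same-block
  with FinP.pigeonhole (ℕP.n<1+n d) (λ a → fromℕ< (m%n<n (x a) d))
... | i , j , i<j , same-residue = FinP.<⇒≢ i<j (x-injective (begin
    x i                   ≡⟨ m≡m%n+[m/n]*n (x i) d ⟩
    x i % d + x i / d * d ≡⟨ cong₂ (λ u v → u + v * d) residue (trans (same-block i) (sym (same-block j))) ⟩
    x j % d + x j / d * d ≡⟨ sym (m≡m%n+[m/n]*n (x j) d) ⟩
    x j                   ∎))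
  where
  open ≡-Reasoning
  residue : x i % d ≡ x j % d
  residue = trans (sym (FinP.toℕ-fromℕ< _)) (trans (cong toℕ same-residue) (FinP.toℕ-fromℕ< _))

almost-stable-tail : {n s : ℕ} {b : Bool} {T : Subset n} → AlmostStable (suc n) s (b ∷ T) → AlmostStable n s T
almost-stable-tail stable i j i∈T j∈T i≢j =
  stable (suc i) (suc j) (there i∈T) (there j∈T) (i≢j ∘ FinP.suc-injective)

almost-stable-span : (s : ℕ) {n m : ℕ} (S : Subset n) → AlmostStable n s S →
                     ∣ S ∣ ≡ suc m → s * m + first S < n
almost-stable-span s {suc n} {zero} (inside ∷ T) stable size =
  s≤s (subst (_≤ n) (sym (trans (ℕP.+-identityʳ (s * 0)) (ℕP.*-zeroʳ s))) z≤n)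
almost-stable-span s {suc n} {suc m} (inside ∷ T) stable size =
  s≤s (begin
    s * suc m + 0          ≡⟨ ℕP.+-identityʳ _ ⟩
    s * suc m              ≡⟨ ℕP.*-suc s m ⟩
    s + s * m              ≡⟨ ℕP.+-comm s (s * m) ⟩
    s * m + s              ≤⟨ ℕP.+-monoʳ-≤ (s * m) gap ⟩
    s * m + suc (first T)  ≡⟨ ℕP.+-suc (s * m) (first T) ⟩
    suc (s * m + first T)  ≤⟨ almost-stable-span s T (almost-stable-tail stable) (ℕP.suc-injective size) ⟩
    n                      ∎)
  where
  open ℕP.≤-Reasoning
  gap : s ≤ suc (first T)
  gap = let (j , j∈T , j-first) = first-∈ T (size⇒nonempty T (ℕP.suc-injective size))
        in subst (λ z → s ≤ suc z) j-first (stable (suc j) zero (there j∈T) here (λ ()))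
almost-stable-span s {suc n} {m} (outside ∷ T) stable size =
  subst (_< suc n) (sym (ℕP.+-suc (s * m) (first T)))
        (s≤s (almost-stable-span s T (almost-stable-tail stable) size))

sum-zero : {r : ℕ} {f : Fin r → ℕ} → (∀ a → f a ≡ 0) → sum f ≡ 0
sum-zero {r} f≗0 = trans (sum-cong-≗ f≗0) (sum-replicate-zero r)

headCount : {n : ℕ} → Subset (suc n) → ℕ
headCount (inside  ∷ _) = 1
headCount (outside ∷ _) = 0

size-split : {n : ℕ} (S : Subset (suc n)) → ∣ S ∣ ≡ headCount S + ∣ tail S ∣
size-split (inside  ∷ S) = refl
size-split (outside ∷ S) = refl

headCount-absent : {n : ℕ} (S : Subset (suc n)) → ¬ zero ∈ S → headCount S ≡ 0
headCount-absent (inside  ∷ S) 0∉S = ⊥-elim (0∉S here)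
headCount-absent (outside ∷ S) _   = refl

headCount≤1 : {n : ℕ} (S : Subset (suc n)) → headCount S ≤ 1
headCount≤1 (inside  ∷ S) = ℕP.≤-refl
headCount≤1 (outside ∷ S) = z≤n

∈-tail : {n : ℕ} (S : Subset (suc n)) {i : Fin n} → i ∈ tail S → suc i ∈ S
∈-tail (_ ∷ S) i∈S = there i∈S

headCounts≤1 : {n r : ℕ} (S : Fin r → Subset (suc n)) → PairwiseDisjoint S →
               sum (headCount ∘ S) ≤ 1
headCounts≤1 {r = zero}  S disjoint = z≤n
headCounts≤1 {r = suc r} S disjoint with zero ∈? S zero
... | yes 0∈S₀ = ℕP.+-mono-≤ (headCount≤1 (S zero)) (ℕP.≤-reflexive (sum-zero others-miss-0))
  where
  others-miss-0 : ∀ a → headCount (S (suc a)) ≡ 0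
  others-miss-0 a = headCount-absent (S (suc a)) (λ 0∈Sₐ → disjoint zero (suc a) (λ ()) zero (0∈S₀ , 0∈Sₐ))
... | no 0∉S₀ = ℕP.≤-trans (ℕP.≤-reflexive (cong (_+ sum (headCount ∘ S ∘ suc)) (headCount-absent (S zero) 0∉S₀)))
                           (headCounts≤1 (S ∘ suc) (λ a b a≢b → disjoint (suc a) (suc b) (a≢b ∘ FinP.suc-injective)))

sizes-split : {n r : ℕ} (S : Fin r → Subset (suc n)) →
              sum (∣_∣ ∘ S) ≡ sum (headCount ∘ S) + sum (∣_∣ ∘ tail ∘ S)
sizes-split S = trans (sum-cong-≗ (size-split ∘ S)) (∑-distrib-+ (headCount ∘ S) (∣_∣ ∘ tail ∘ S))

tails-disjoint : {n r : ℕ} (S : Fin r → Subset (suc n)) → PairwiseDisjoint S →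
                 PairwiseDisjoint (tail ∘ S)
tails-disjoint S disjoint a b a≢b x (x∈a , x∈b) =
  disjoint a b a≢b (suc x) (∈-tail (S a) x∈a , ∈-tail (S b) x∈b)

disjoint-sizes≤ : (n L : ℕ) {r : ℕ} (S : Fin r → Subset n) → PairwiseDisjoint S →
                  (∀ a {i} → i ∈ S a → L ≤ toℕ i) → sum (∣_∣ ∘ S) ≤ n ∸ L
disjoint-sizes≤ zero L S _ _ =
  ℕP.≤-reflexive (trans (sum-zero (λ a → empty-size (S a))) (sym (ℕP.0∸n≡0 L)))
  where
  empty-size : (T : Subset 0) → ∣ T ∣ ≡ 0
  empty-size [] = refl
disjoint-sizes≤ (suc n) zero S disjoint _ =
  subst (_≤ suc n) (sym (sizes-split S))
        (ℕP.+-mono-≤ (headCounts≤1 S disjoint)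
                     (disjoint-sizes≤ n zero (tail ∘ S) (tails-disjoint S disjoint) (λ _ _ → z≤n)))
disjoint-sizes≤ (suc n) (suc L) S disjoint above =
  subst (_≤ n ∸ L) (sym (trans (sizes-split S) (cong (_+ sum (∣_∣ ∘ tail ∘ S)) (sum-zero heads-miss))))
        (disjoint-sizes≤ n L (tail ∘ S) (tails-disjoint S disjoint)
                         (λ a i∈ → ℕP.≤-pred (above a (∈-tail (S a) i∈))))
  where
  heads-miss : ∀ a → headCount (S a) ≡ 0
  heads-miss a = headCount-absent (S a) (λ 0∈Sₐ → ℕP.<-irrefl refl (ℕP.≤-trans (above a 0∈Sₐ) z≤n))

sum-const : (r k : ℕ) → sum {r} (λ _ → k) ≡ r * k
sum-const zero    k = refl
sum-const (suc r) k = cong (k +_) (sum-const r k)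

ceilDiv-covers : (a b : ℕ) → a ≤ ceilDiv a (suc b) * suc b
ceilDiv-covers a b = ℕP.+-cancelʳ-≤ b a (q * suc b) (begin
  a + b                        ≡⟨ m≡m%n+[m/n]*n (a + b) (suc b) ⟩
  (a + b) % suc b + q * suc b  ≤⟨ ℕP.+-monoˡ-≤ (q * suc b) (ℕP.≤-pred (m%n<n (a + b) (suc b))) ⟩
  b + q * suc b                ≡⟨ ℕP.+-comm b (q * suc b) ⟩
  q * suc b + b                ∎)
  where
  open ℕP.≤-Reasoning
  q : ℕ
  q = ceilDiv a (suc b)

ceilDiv-positive : (a b : ℕ) → 1 ≤ a → 1 ≤ ceilDiv a (suc b)
ceilDiv-positive a b 1≤a = m≥n⇒m/n>0 (ℕP.+-monoˡ-≤ b 1≤a)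

⊓-below : {u w : ℕ} → u ⊓ w < w → u ⊓ w ≡ u
⊓-below {u} {w} u⊓w<w with ℕP.⊓-sel u w
... | inj₁ u⊓w≡u = u⊓w≡u
... | inj₂ u⊓w≡w = ⊥-elim (ℕP.<-irrefl u⊓w≡w u⊓w<w)

-- The coloring behind the upper bound, for edges of r = d+1 sets of size k = K+1.
-- With q = ⌈(n - max(r,s)·K)/d⌉, a vertex S gets color min(⌊first S / d⌋, q-1):
-- members of a monochromatic edge would have their least elements in one block of
-- length d, which is impossible for d+1 disjoint sets, or all in the last block.
module UpperBound (n r′ K s : ℕ) (room : (suc (suc r′) ⊔ s) * suc K ≤ n) where

  d r k M N q q′ : ℕ
  d  = suc r′
  r  = suc d
  k  = suc K
  M  = r ⊔ s
  N  = n ∸ M * K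
  q  = ceilDiv N d
  q′ = q ∸ 1

  n≡N+MK : n ≡ N + M * K
  n≡N+MK = sym (ℕP.m∸n+n≡m (ℕP.≤-trans (ℕP.*-monoʳ-≤ M (ℕP.n≤1+n K)) room))

  -- M·K + M = M·k ≤ n, so N ≥ M ≥ 1.
  N-positive : 1 ≤ N
  N-positive = ℕP.+-cancelʳ-≤ (M * K) 1 N (begin
    1 + M * K  ≤⟨ ℕP.+-monoˡ-≤ (M * K) (ℕP.≤-trans (s≤s z≤n) (ℕP.m≤m⊔n r s)) ⟩
    M + M * K  ≡⟨ sym (ℕP.*-suc M K) ⟩
    M * k      ≤⟨ room ⟩
    n          ≡⟨ n≡N+MK ⟩
    N + M * K  ∎)
    where open ℕP.≤-Reasoning

  q≡1+q′ : q ≡ suc q′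
  q≡1+q′ = trans (sym (ℕP.m∸n+n≡m (ceilDiv-positive N r′ N-positive))) (ℕP.+-comm q′ 1)

  block : ℕ → ℕ
  block x = x / d

  colorℕ : Subset n → ℕ
  colorℕ S = block (first S) ⊓ q′

  color : Vertex n k (AlmostStable n s) → Fin (suc q′)
  color (S , _) = fromℕ< (s≤s (ℕP.m⊓n≤n (block (first S)) q′))

  -- If s ≥ r, every vertex starts before position N ≤ q·d, i.e. in a block < q.
  top-block-bound : r ≤ s → (v : Vertex n k (AlmostStable n s)) → block (first (proj₁ v)) ≤ q′
  top-block-bound r≤s (S , size , stable) =
    ℕP.≤-pred (subst (block (first S) <_) q≡1+q′ (m<n*o⇒m/o<n (ℕP.<-≤-trans first<N (ceilDiv-covers N r′))))
    where
    first<N : first S < N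
    first<N = subst (λ m → first S < n ∸ m * K) (sym (ℕP.m≤n⇒m⊔n≡n r≤s))
      (ℕP.m+n≤o⇒m≤o∸n (suc (first S))
        (subst (_≤ n) (cong suc (ℕP.+-comm (s * K) (first S))) (almost-stable-span s S stable size)))

  top-block-crowded : ¬ r ≤ s → n ∸ q′ * d < r * k
  top-block-crowded r≰s = subst (n ∸ q′ * d <_) (sym (ℕP.*-suc r K))
    (s≤s (subst (n ∸ q′ * d ≤_) (ℕP.m+n∸n≡m (d + r * K) (q′ * d)) (ℕP.∸-monoˡ-≤ (q′ * d) n≤top)))
    where
    open ℕP.≤-Reasoning
    n≤top : n ≤ (d + r * K) + q′ * d
    n≤top = begin
      n                       ≡⟨ n≡N+MK ⟩
      N + M * K               ≡⟨ cong (λ m → N + m * K) (ℕP.m≥n⇒m⊔n≡m (ℕP.<⇒≤ (ℕP.≰⇒> r≰s))) ⟩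
      N + r * K               ≤⟨ ℕP.+-monoˡ-≤ (r * K) (ceilDiv-covers N r′) ⟩
      q * d + r * K           ≡⟨ cong (λ m → m * d + r * K) q≡1+q′ ⟩
      (d + q′ * d) + r * K    ≡⟨ ℕP.+-assoc d (q′ * d) (r * K) ⟩
      d + (q′ * d + r * K)    ≡⟨ cong (d +_) (ℕP.+-comm (q′ * d) (r * K)) ⟩
      d + (r * K + q′ * d)    ≡⟨ sym (ℕP.+-assoc d (r * K) (q′ * d)) ⟩
      (d + r * K) + q′ * d    ∎

  module MonochromaticEdge (e : Fin r → Vertex n k (AlmostStable n s))
                           (edge : IsEdge n k r (AlmostStable n s) e)
                           (mono : ∀ a b → color (e a) ≡ color (e b)) where

    S : Fin r → Subset n
    S = proj₁ ∘ e

    c : ℕ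
    c = colorℕ (S zero)

    same-color : ∀ a → colorℕ (S a) ≡ c
    same-color a = trans (sym (FinP.toℕ-fromℕ< _)) (trans (cong toℕ (mono a zero)) (FinP.toℕ-fromℕ< _))

    no-common-block-of-firsts : (t : ℕ) → ¬ (∀ a → block (first (S a)) ≡ t)
    no-common-block-of-firsts = no-common-block d (first ∘ S)
      (distinct-firsts S (λ a → size⇒nonempty (S a) (proj₁ (proj₂ (e a)))) edge)

    low-color : c < q′ → ∀ a → block (first (S a)) ≡ c
    low-color c<q′ a = trans (sym (⊓-below (subst (_< q′) (sym (same-color a)) c<q′))) (same-color a)

    top-color : c ≡ q′ → ∀ a → q′ ≤ block (first (S a))
    top-color c≡q′ a = ℕP.m⊓n≡n⇒n≤m (trans (same-color a) c≡q′)

    members-above : c ≡ q′ → r * k ≤ n ∸ q′ * d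
    members-above c≡q′ = begin
      r * k             ≡⟨ sym (sum-const r k) ⟩
      sum {r} (λ _ → k) ≡⟨ sym (sum-cong-≗ (proj₁ ∘ proj₂ ∘ e)) ⟩
      sum (∣_∣ ∘ S)     ≤⟨ disjoint-sizes≤ n (q′ * d) S edge above ⟩
      n ∸ q′ * d        ∎
      where
      open ℕP.≤-Reasoning
      above : ∀ a {i} → i ∈ S a → q′ * d ≤ toℕ i
      above a i∈Sₐ = ℕP.≤-trans (ℕP.*-monoˡ-≤ d (top-color c≡q′ a))
                     (ℕP.≤-trans (m/n*n≤m (first (S a)) d) (first-≤ (S a) i∈Sₐ))

    impossible : ⊥
    impossible with ℕP.m≤n⇒m<n∨m≡n (ℕP.m⊓n≤n (block (first (S zero))) q′)
    ... | inj₁ c<q′ = no-common-block-of-firsts c (low-color c<q′)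
    ... | inj₂ c≡q′ with r ≤? s
    ...   | yes r≤s = no-common-block-of-firsts q′
                        (λ a → ℕP.≤-antisym (top-block-bound r≤s (e a)) (top-color c≡q′ a))
    ...   | no  r≰s = ℕP.<-irrefl refl (ℕP.≤-<-trans (members-above c≡q′) (top-block-crowded r≰s))

  colorable : Colorable n k r (AlmostStable n s) q
  colorable = subst (Colorable n k r (AlmostStable n s)) (sym q≡1+q′)
                    (color , λ e edge mono → MonochromaticEdge.impossible e edge mono)

lemma1p5 : (n k r s : ℕ) → 1 ≤ n → 2 ≤ k → 2 ≤ r → 1 ≤ s →
    (r ⊔ s) * k ≤ n →
    Σ ℕ (λ χs → Σ ℕ (λ χa →
      IsChromaticNumber n k r (Stable n s) χs ×
      IsChromaticNumber n k r (AlmostStable n s) χa ×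
      (χs ≤ χa) ×
      (χa ≤ ceilDiv (n ∸ (r ⊔ s) * (k ∸ 1)) (r ∸ 1))))
lemma1p5 n (suc (suc k″)) (suc (suc r′)) s _ (s≤s (s≤s _)) (s≤s (s≤s _)) _ room =
  chromatic-numbers-ordered (stable? n s) (almostStable? n s) zero stable⇒almostStable
    (UpperBound.colorable n r′ (suc k″) s room)
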